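{- Let $P$ be a finite poset with minimum $\hat0$ and maximum $\hat1$ and at least 3 elements. Let $c$ be a coatom of $P$ and let $\sim$ be the equivalence relation whose only non-singleton class is $\{c,\hat1\}$. Then $P/\sim$ is a homogeneous quotient and $$\mu([\hat1])=\mu(c)+\mu(\hat1).$$ Moreover, if $P$ is a lattice, then $P/\sim$ is a lattice with $[x]\vee[y]=[x\vee y]$ for all $x,y\in P$, and $[x]\wedge[y]=[x\wedge y]$ whenever $[x],[y]\neq[\hat1]$.
   Context: $[x]$ denotes the equivalence class of $x$. For an equivalence relation $\sim$ on a poset $P$, the quotient $P/\sim$ is the set of classes with $X\le Y$ iff $x\le y$ for some $x\in X$, $y\in Y$. It is a homogeneous quotient if (1) $\hat0$ is in a class by itself, and (2) whenever $X\le Y$ in $P/\sim$, for every $x\in X$ there is $y\in Y$ with $x\le y$. The Möbius function $\mu$ of a poset with minimum $\hat0$ is defined by $\sum_{y\le x}\mu(y)=\delta_{\hat0,x}$; on the left side, $\mu$ is that of $P/\sim$, and on the right side that of $P$. -}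

module Defs where

open import Level using (0ℓ)
open import Data.Nat using (ℕ)
open import Data.Fin using (Fin) renaming (_≤_ to _≤ᶠ_; _≤?_ to _≤ᶠ?_)
open import Data.Fin.Properties using (any?; all?; _≟_)
open import Data.Integer using (ℤ; 0ℤ; 1ℤ; _+_)
open import Data.List using (List; filter; map; foldr)
open import Data.Product using (Σ; ∃; _×_; _,_)
open import Data.Sum using (_⊎_)
open import Relation.Binary using (Rel; IsDecPartialOrder)
open import Relation.Binary.PropositionalEquality using (_≡_)
open import Relation.Nullary using (Dec; yes; no; ¬_)
open import Relation.Nullary.Decidable using (_×-dec_; _⊎-dec_; _→-dec_)
import Data.List as L

-- A finite poset, with carrier Fin n (every finite poset is isomorphic to one of these).
record FinPoset (n : ℕ) : Set₁ where
  field
    _≤_ : Rel (Fin n) 0ℓ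
    isDecPartialOrder : IsDecPartialOrder _≡_ _≤_
  open IsDecPartialOrder isDecPartialOrder public
    using (_≤?_) renaming (refl to ≤-refl; trans to ≤-trans; antisym to ≤-antisym)

sum : List ℤ → ℤ
sum = foldr _+_ 0ℤ

δ : {A : Set} → Dec A → ℤ
δ (yes _) = 1ℤ
δ (no _)  = 0ℤ

elems : (n : ℕ) → List (Fin n)
elems n = L.allFin n

module _ {n : ℕ} (P : FinPoset n) where
  open FinPoset P

  IsMin : Fin n → Set
  IsMin z = ∀ x → z ≤ x

  IsMax : Fin n → Set
  IsMax t = ∀ x → x ≤ t

  IsCoatom : Fin n → Fin n → Set
  IsCoatom t c = c ≤ t × ¬ (c ≡ t) × (∀ z → c ≤ z → z ≤ t → z ≡ c ⊎ z ≡ t)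

  IsMobius : Fin n → (Fin n → ℤ) → Set
  IsMobius z μ = ∀ x → sum (map μ (filter (λ y → y ≤? x) (elems n))) ≡ δ (z ≟ x)

  IsJoin : Fin n → Fin n → Fin n → Set
  IsJoin x y j = x ≤ j × y ≤ j × (∀ w → x ≤ w → y ≤ w → j ≤ w)

  IsMeet : Fin n → Fin n → Fin n → Set
  IsMeet x y m = m ≤ x × m ≤ y × (∀ w → w ≤ x → w ≤ y → w ≤ m)

  IsLattice : Set
  IsLattice = ∀ x y → (∃ λ j → IsJoin x y j) × (∃ λ m → IsMeet x y m)

  -- Quotient by an (decidable) equivalence relation _~_.  A class is
  -- represented by any of its elements; [x] ≤ [y] in P/~ is QLe x y.
  module Quotient (_~_ : Rel (Fin n) 0ℓ) (_~?_ : ∀ x y → Dec (x ~ y)) where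

    QLe : Fin n → Fin n → Set
    QLe x y = ∃ λ x' → ∃ λ y' → x' ~ x × y' ~ y × x' ≤ y'

    QLe? : ∀ x y → Dec (QLe x y)
    QLe? x y = any? (λ x' → any? (λ y' → (x' ~? x) ×-dec ((y' ~? y) ×-dec (x' ≤? y'))))

    IsHomogeneous : Fin n → Set
    IsHomogeneous z =
      (∀ x → x ~ z → x ≡ z) ×
      (∀ x y → QLe x y → ∀ x' → x' ~ x → ∃ λ y' → y' ~ y × x' ≤ y')

    IsRep : Fin n → Set
    IsRep y = ∀ w → w ~ y → y ≤ᶠ w

    IsRep? : ∀ y → Dec (IsRep y)
    IsRep? y = all? (λ w → (w ~? y) →-dec (y ≤ᶠ? w))

    -- μQ : Fin n → ℤ, constant on classes, is the Möbius function of P/~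
    -- (μQ x stands for μ([x])); the quotient minimum is [z].
    -- Σ_{Y ≤ [x]} μ(Y) = δ([z],[x]), summing over classes via their representatives.
    IsQMobius : Fin n → (Fin n → ℤ) → Set
    IsQMobius z μQ =
      (∀ x y → x ~ y → μQ x ≡ μQ y) ×
      (∀ x → sum (map μQ (filter (λ y → IsRep? y ×-dec QLe? y x) (elems n))) ≡ δ (x ~? z))

    IsQJoin : Fin n → Fin n → Fin n → Set
    IsQJoin x y j = QLe x j × QLe y j × (∀ w → QLe x w → QLe y w → QLe j w)

    IsQMeet : Fin n → Fin n → Fin n → Set
    IsQMeet x y m = QLe m x × QLe m y × (∀ w → QLe w x → QLe w y → QLe w m)

    IsQLattice : Set
    IsQLattice =
      (∀ x → QLe x x) ×
      (∀ x y w → QLe x y → QLe y w → QLe x w) ×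
      (∀ x y → QLe x y → QLe y x → x ~ y) ×
      (∀ x y → (∃ λ j → IsQJoin x y j) × (∃ λ m → IsQMeet x y m))

module _ {n : ℕ} (c t : Fin n) where
  InPair : Fin n → Set
  InPair x = x ≡ c ⊎ x ≡ t

  InPair? : ∀ x → Dec (InPair x)
  InPair? x = (x ≟ c) ⊎-dec (x ≟ t)

  Collapse : Rel (Fin n) 0ℓ
  Collapse x y = x ≡ y ⊎ (InPair x × InPair y)

  Collapse? : ∀ x y → Dec (Collapse x y)
  Collapse? x y = (x ≟ y) ⊎-dec (InPair? x ×-dec InPair? y)

-- Since c is a coatom, the class {c, 1̂} is an up-set, so below any x ∉ {c, 1̂}
-- the quotient is a copy of P below x. This gives homogeneity and the lattice
-- operations, and μ([x]) = μ(x) for x ∉ {c, 1̂}, because both functions satisfy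
-- the Möbius recursion on that down-set. At [1̂] both defining sums vanish
-- (0̂ ∉ {c, 1̂} as P has three elements) and share the terms μ(x), x ∉ {c, 1̂};
-- what remains is μ([1̂]) on one side and μ(c) + μ(1̂) on the other.
module Submission where

open import Defs
open import Level using (0ℓ)
open import Data.Nat using (ℕ; _≤_; s≤s)
open import Data.Fin using (Fin; zero; suc)
open import Data.Fin.Patterns using (0F; 1F; 2F)
import Data.Fin.Properties as Fin
open import Data.Fin.Induction using (po-wellFounded)
open import Data.Integer using (ℤ; 0ℤ; _+_)
import Data.Integer.Properties as ℤ
open import Algebra.Properties.AbelianGroup ℤ.+-0-abelianGroup using (∙-cancelʳ)
open import Algebra.Properties.CommutativeMonoid.Sum ℤ.+-0-commutativeMonoid
  using (sum-syntax; sum-cong-≗; sum-replicate-zero; ∑-distrib-+)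
open import Data.List using (List; []; _∷_; map; filter; tabulate)
import Data.List.Properties as List
open import Data.Product using (_×_; _,_; ∃; proj₁; proj₂)
open import Data.Sum using (_⊎_; inj₁; inj₂)
open import Data.Empty using (⊥-elim)
open import Function using (_⇔_; mk⇔; Equivalence; _∘_; id)
open import Induction.WellFounded using (Acc; acc)
open import Relation.Binary using (IsDecPartialOrder; Rel)
import Relation.Binary.Construct.NonStrictToStrict as NonStrictToStrict
open import Relation.Binary.PropositionalEquality
  using (_≡_; refl; sym; trans; cong; cong₂; module ≡-Reasoning)
open import Relation.Nullary using (¬_; Dec; yes; no; ¬?)
open import Relation.Nullary.Decidable using (_×-dec_; _⊎-dec_)
open import Relation.Unary using (Pred; Decidable; ∁)
open import Relation.Unary.Properties using (_∩?_; _∪?_; ∁?)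

open Equivalence using (to; from)

private variable
  A B : Set

when : Dec A → ℤ → ℤ
when (yes _) v = v
when (no _)  _ = 0ℤ

when-yes : (d : Dec A) {v : ℤ} → A → when d v ≡ v
when-yes (yes _) _ = refl
when-yes (no ¬a) a = ⊥-elim (¬a a)

when-no : (d : Dec A) {v : ℤ} → ¬ A → when d v ≡ 0ℤ
when-no (yes a) ¬a = ⊥-elim (¬a a)
when-no (no _)  _  = refl

when-cong : (d : Dec A) (e : Dec B) {u v : ℤ} → A ⇔ B → (A → u ≡ v) → when d u ≡ when e v
when-cong (yes a) (yes _) _   u≡v = u≡v a
when-cong (yes a) (no ¬b) A⇔B _   = ⊥-elim (¬b (to A⇔B a))
when-cong (no ¬a) (yes b) A⇔B _   = ⊥-elim (¬a (from A⇔B b))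
when-cong (no _)  (no _)  _   _   = refl

when-split : (d : Dec A) (e : Dec B) (v : ℤ) →
  when d v ≡ when (d ×-dec e) v + when (d ×-dec ¬? e) v
when-split (yes _) (yes _) v = sym (ℤ.+-identityʳ v)
when-split (yes _) (no _)  v = sym (ℤ.+-identityˡ v)
when-split (no _)  _       v = refl

when-⊎ : (d : Dec A) (e : Dec B) (v : ℤ) → ¬ (A × B) →
  when (d ⊎-dec e) v ≡ when d v + when e v
when-⊎ (yes a) (yes b) v disj = ⊥-elim (disj (a , b))
when-⊎ (yes _) (no _)  v _    = sym (ℤ.+-identityʳ v)
when-⊎ (no _)  (yes _) v _    = sym (ℤ.+-identityˡ v)
when-⊎ (no _)  (no _)  v _    = refl

δ-no : (d : Dec A) → ¬ A → δ d ≡ 0ℤ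
δ-no (yes a) ¬a = ⊥-elim (¬a a)
δ-no (no _)  _  = refl

δ-cong : (d : Dec A) (e : Dec B) → A ⇔ B → δ d ≡ δ e
δ-cong (yes _) (yes _) _   = refl
δ-cong (yes a) (no ¬b) A⇔B = ⊥-elim (¬b (to A⇔B a))
δ-cong (no ¬a) (yes b) A⇔B = ⊥-elim (¬a (from A⇔B b))
δ-cong (no _)  (no _)  _   = refl

sum-filter : {Q : Pred A 0ℓ} (Q? : Decidable Q) (f : A → ℤ) (xs : List A) →
  sum (map f (filter Q? xs)) ≡ sum (map (λ y → when (Q? y) (f y)) xs)
sum-filter Q? f []       = refl
sum-filter Q? f (x ∷ xs) with Q? x
... | yes _ = cong (f x +_) (sum-filter Q? f xs)
... | no _  = trans (sum-filter Q? f xs) (sym (ℤ.+-identityˡ _))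

sum-tabulate : ∀ {n} (f : Fin n → ℤ) → sum (tabulate f) ≡ ∑[ i < n ] f i
sum-tabulate {ℕ.zero}  f = refl
sum-tabulate {ℕ.suc n} f = cong (f zero +_) (sum-tabulate (f ∘ suc))

module _ {n : ℕ} where

  sumWhere : {Q : Pred (Fin n) 0ℓ} → Decidable Q → (Fin n → ℤ) → ℤ
  sumWhere Q? f = ∑[ y < n ] when (Q? y) (f y)

  sum-filter-elems : {Q : Pred (Fin n) 0ℓ} (Q? : Decidable Q) (f : Fin n → ℤ) →
    sum (map f (filter Q? (elems n))) ≡ sumWhere Q? f
  sum-filter-elems Q? f = begin
    sum (map f (filter Q? (elems n)))      ≡⟨ sum-filter Q? f (elems n) ⟩
    sum (map f′ (elems n))                 ≡⟨ cong sum (List.map-tabulate id f′) ⟩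
    sum (tabulate f′)                      ≡⟨ sum-tabulate f′ ⟩
    sumWhere Q? f                          ∎
    where
    open ≡-Reasoning
    f′ : Fin n → ℤ
    f′ y = when (Q? y) (f y)

  module _ {Q R : Pred (Fin n) 0ℓ} (Q? : Decidable Q) (R? : Decidable R) where

    sumWhere-cong : {f g : Fin n → ℤ} → (∀ y → Q y ⇔ R y) → (∀ y → Q y → f y ≡ g y) →
      sumWhere Q? f ≡ sumWhere R? g
    sumWhere-cong Q⇔R f≡g = sum-cong-≗ λ y → when-cong (Q? y) (R? y) (Q⇔R y) (f≡g y)

    sumWhere-split : (f : Fin n → ℤ) →
      sumWhere Q? f ≡ sumWhere (Q? ∩? R?) f + sumWhere (Q? ∩? ∁? R?) f
    sumWhere-split f = trans (sum-cong-≗ λ y → when-split (Q? y) (R? y) (f y))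
      (∑-distrib-+ (λ y → when ((Q? ∩? R?) y) (f y)) (λ y → when ((Q? ∩? ∁? R?) y) (f y)))

    sumWhere-∪ : (f : Fin n → ℤ) → (∀ y → ¬ (Q y × R y)) →
      sumWhere (Q? ∪? R?) f ≡ sumWhere Q? f + sumWhere R? f
    sumWhere-∪ f disjoint =
      trans (sum-cong-≗ λ y → when-⊎ (Q? y) (R? y) (f y) (disjoint y))
        (∑-distrib-+ (λ y → when (Q? y) (f y)) (λ y → when (R? y) (f y)))

sumWhere-≟ : ∀ {n} (x : Fin n) (f : Fin n → ℤ) → sumWhere (Fin._≟ x) f ≡ f x
sumWhere-≟ {ℕ.suc n} zero f = begin
  when (zero {n} Fin.≟ zero) (f zero) + ∑[ y < n ] when (suc y Fin.≟ zero) (f (suc y))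
    ≡⟨ cong₂ _+_ (when-yes (zero {n} Fin.≟ zero) {f zero} refl)
                 (sum-cong-≗ λ y → when-no (suc y Fin.≟ zero) {f (suc y)} λ ()) ⟩
  f zero + ∑[ y < n ] 0ℤ
    ≡⟨ cong (f zero +_) (sum-replicate-zero n) ⟩
  f zero + 0ℤ
    ≡⟨ ℤ.+-identityʳ (f zero) ⟩
  f zero ∎
  where open ≡-Reasoning
sumWhere-≟ {ℕ.suc n} (suc x) f = begin
  when (zero {n} Fin.≟ suc x) (f zero) + ∑[ y < n ] when (suc y Fin.≟ suc x) (f (suc y))
    ≡⟨ cong₂ _+_ (when-no (zero Fin.≟ suc x) {f zero} λ ())
                 (sum-cong-≗ λ y → when-cong (suc y Fin.≟ suc x) (y Fin.≟ x)
                                     (mk⇔ Fin.suc-injective (cong suc)) λ _ → refl) ⟩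
  0ℤ + sumWhere (Fin._≟ x) (f ∘ suc)
    ≡⟨ ℤ.+-identityˡ _ ⟩
  sumWhere (Fin._≟ x) (f ∘ suc)
    ≡⟨ sumWhere-≟ x (f ∘ suc) ⟩
  f (suc x) ∎
  where open ≡-Reasoning

module _ {n : ℕ} (P : FinPoset n) where
  open FinPoset P renaming (_≤_ to _⊑_)

  sumBelow : (Fin n → ℤ) → Fin n → ℤ
  sumBelow f x = sumWhere (_≤? x) f

  private
    _⊏_ : Rel (Fin n) 0ℓ
    _⊏_ = NonStrictToStrict._<_ _≡_ _⊑_

    _⊏?_ : ∀ y x → Dec (y ⊏ x)
    y ⊏? x = (y ≤? x) ×-dec ¬? (y Fin.≟ x)

  sumBelow-unfold : ∀ f x → sumBelow f x ≡ f x + sumWhere (_⊏? x) f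
  sumBelow-unfold f x = begin
    sumBelow f x
      ≡⟨ sumWhere-split (_≤? x) (Fin._≟ x) f ⟩
    sumWhere ((_≤? x) ∩? (Fin._≟ x)) f + sumWhere (_⊏? x) f
      ≡⟨ cong (_+ sumWhere (_⊏? x) f) (sumWhere-cong _ (Fin._≟ x) at-x (λ _ _ → refl)) ⟩
    sumWhere (Fin._≟ x) f + sumWhere (_⊏? x) f
      ≡⟨ cong (_+ sumWhere (_⊏? x) f) (sumWhere-≟ x f) ⟩
    f x + sumWhere (_⊏? x) f ∎
    where
    open ≡-Reasoning
    at-x : ∀ y → (y ⊑ x × y ≡ x) ⇔ y ≡ x
    at-x y = mk⇔ proj₂ λ { refl → ≤-refl , refl }

  sumBelow-injective-on-downset : (D : Pred (Fin n) 0ℓ) → (∀ {x y} → y ⊑ x → D x → D y) →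
    (f g : Fin n → ℤ) → (∀ x → D x → sumBelow f x ≡ sumBelow g x) →
    ∀ x → D x → f x ≡ g x
  sumBelow-injective-on-downset D downward f g same-sums x =
    go x (po-wellFounded (IsDecPartialOrder.isPartialOrder isDecPartialOrder) x)
    where
    go : ∀ x → Acc _⊏_ x → D x → f x ≡ g x
    go x (acc below) Dx = ∙-cancelʳ (sumWhere (_⊏? x) f) (f x) (g x) (begin
      f x + sumWhere (_⊏? x) f   ≡⟨ sym (sumBelow-unfold f x) ⟩
      sumBelow f x               ≡⟨ same-sums x Dx ⟩
      sumBelow g x               ≡⟨ sumBelow-unfold g x ⟩
      g x + sumWhere (_⊏? x) g   ≡⟨ cong (g x +_) (sym strictly-below) ⟩
      g x + sumWhere (_⊏? x) f   ∎)
      where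
      open ≡-Reasoning
      strictly-below : sumWhere (_⊏? x) f ≡ sumWhere (_⊏? x) g
      strictly-below = sumWhere-cong (_⊏? x) (_⊏? x) (λ _ → mk⇔ id id)
        λ y y⊏x → go y (below y⊏x) (downward (proj₁ y⊏x) Dx)

pair-pigeonhole : ∀ {n} {c t a b d : Fin n} →
  InPair c t a → InPair c t b → InPair c t d → a ≡ b ⊎ b ≡ d ⊎ a ≡ d
pair-pigeonhole (inj₁ refl) (inj₁ refl) _           = inj₁ refl
pair-pigeonhole (inj₂ refl) (inj₂ refl) _           = inj₁ refl
pair-pigeonhole (inj₁ refl) (inj₂ refl) (inj₁ refl) = inj₂ (inj₂ refl)
pair-pigeonhole (inj₁ refl) (inj₂ refl) (inj₂ refl) = inj₂ (inj₁ refl)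
pair-pigeonhole (inj₂ refl) (inj₁ refl) (inj₁ refl) = inj₂ (inj₁ refl)
pair-pigeonhole (inj₂ refl) (inj₁ refl) (inj₂ refl) = inj₂ (inj₂ refl)

¬InPair-all : ∀ {n} (c t : Fin n) → 3 ≤ n → ¬ (∀ x → InPair c t x)
¬InPair-all c t (s≤s (s≤s (s≤s _))) all-in-pair
  with pair-pigeonhole (all-in-pair 0F) (all-in-pair 1F) (all-in-pair 2F)
... | inj₁ ()
... | inj₂ (inj₁ ())
... | inj₂ (inj₂ ())

module CoatomCollapse {n : ℕ} (P : FinPoset n) (t c : Fin n)
  (t-max : IsMax P t) (c-coatom : IsCoatom P t c) where
  open FinPoset P renaming (_≤_ to _⊑_)
  open Quotient P (Collapse c t) (Collapse? c t)

  Pair : Pred (Fin n) 0ℓ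
  Pair = InPair c t

  Pair? : Decidable Pair
  Pair? = InPair? c t

  _~_ : Rel (Fin n) 0ℓ
  _~_ = Collapse c t

  ~-refl : ∀ {x} → x ~ x
  ~-refl = inj₁ refl

  ~-sym : ∀ {x y} → x ~ y → y ~ x
  ~-sym (inj₁ refl)    = inj₁ refl
  ~-sym (inj₂ (p , q)) = inj₂ (q , p)

  ~-trans : ∀ {x y w} → x ~ y → y ~ w → x ~ w
  ~-trans (inj₁ refl)    y~w            = y~w
  ~-trans x~y            (inj₁ refl)    = x~y
  ~-trans (inj₂ (p , _)) (inj₂ (_ , q)) = inj₂ (p , q)

  pair-~t : ∀ {x} → Pair x → x ~ t
  pair-~t px = inj₂ (px , inj₂ refl)

  pair-respects-~ : ∀ {x y} → Pair x → x ~ y → Pair y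
  pair-respects-~ px (inj₁ refl)     = px
  pair-respects-~ _  (inj₂ (_ , py)) = py

  ~-off-pair : ∀ {x y} → ¬ Pair y → x ~ y → x ≡ y
  ~-off-pair _   (inj₁ x≡y)      = x≡y
  ~-off-pair ¬py (inj₂ (_ , py)) = ⊥-elim (¬py py)

  pair-upward : ∀ {x y} → Pair x → x ⊑ y → Pair y
  pair-upward {y = y} (inj₁ refl) c⊑y = proj₂ (proj₂ c-coatom) y c⊑y (t-max y)
  pair-upward {y = y} (inj₂ refl) t⊑y = inj₂ (≤-antisym (t-max y) t⊑y)

  min-off-pair : ∀ {z} → 3 ≤ n → IsMin P z → ¬ Pair z
  min-off-pair 3≤n z-min pz = ¬InPair-all c t 3≤n λ x → pair-upward pz (z-min x)

  QLe-of-⊑ : ∀ {x y} → x ⊑ y → QLe x y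
  QLe-of-⊑ x⊑y = _ , _ , ~-refl , ~-refl , x⊑y

  QLe-pair : ∀ {x} y → Pair x → QLe y x
  QLe-pair y px = y , t , ~-refl , ~-sym (pair-~t px) , t-max y

  -- If x′ differs from the witness x₁, both lie in the up-set {c, t}, and t serves as y′.
  QLe-lift : ∀ x y → QLe x y → ∀ x′ → x′ ~ x → ∃ λ y′ → y′ ~ y × x′ ⊑ y′
  QLe-lift x y (x₁ , y₁ , x₁~x , y₁~y , x₁⊑y₁) x′ x′~x with ~-trans x′~x (~-sym x₁~x)
  ... | inj₁ refl       = y₁ , y₁~y , x₁⊑y₁
  ... | inj₂ (_ , px₁) =
    t , ~-trans (~-sym (pair-~t (pair-upward px₁ x₁⊑y₁))) y₁~y , t-max x′

  isHomogeneous : ∀ {z} → ¬ Pair z → IsHomogeneous z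
  isHomogeneous ¬pz = (λ _ → ~-off-pair ¬pz) , QLe-lift

  QLe-refl : ∀ x → QLe x x
  QLe-refl x = QLe-of-⊑ ≤-refl

  QLe-trans : ∀ x y w → QLe x y → QLe y w → QLe x w
  QLe-trans x y w (x₁ , y₁ , x₁~x , y₁~y , x₁⊑y₁) y≤w
    with QLe-lift y w y≤w y₁ y₁~y
  ... | w₁ , w₁~w , y₁⊑w₁ = x₁ , w₁ , x₁~x , w₁~w , ≤-trans x₁⊑y₁ y₁⊑w₁

  QLe-antisym : ∀ x y → QLe x y → QLe y x → x ~ y
  QLe-antisym x y x≤y y≤x with QLe-lift x y x≤y x ~-refl
  ... | y₁ , y₁~y , x⊑y₁ with QLe-lift y x y≤x y₁ y₁~y
  ... | _ , inj₁ refl , y₁⊑x        = ~-trans (inj₁ (≤-antisym x⊑y₁ y₁⊑x)) y₁~y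
  ... | _ , inj₂ (_ , px) , _       = inj₂ (px , pair-respects-~ (pair-upward px x⊑y₁) y₁~y)

  join-lifts : ∀ x y j → IsJoin P x y j → IsQJoin x y j
  join-lifts x y j (x⊑j , y⊑j , least) = QLe-of-⊑ x⊑j , QLe-of-⊑ y⊑j , least-class
    where
    least-class : ∀ w → QLe x w → QLe y w → QLe j w
    least-class w x≤w y≤w with QLe-lift x w x≤w x ~-refl | QLe-lift y w y≤w y ~-refl
    ... | w₁ , w₁~w , x⊑w₁ | w₂ , w₂~w , y⊑w₂ with ~-trans w₁~w (~-sym w₂~w)
    ... | inj₁ refl     = j , w₁ , ~-refl , w₁~w , least w₁ x⊑w₁ y⊑w₂
    ... | inj₂ (pw , _) = QLe-pair j (pair-respects-~ pw w₁~w)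

  meet-lifts : ∀ x y m → ¬ Pair x → ¬ Pair y → IsMeet P x y m → IsQMeet x y m
  meet-lifts x y m ¬px ¬py (m⊑x , m⊑y , greatest) =
    QLe-of-⊑ m⊑x , QLe-of-⊑ m⊑y , greatest-class
    where
    greatest-class : ∀ w → QLe w x → QLe w y → QLe w m
    greatest-class w (w₁ , x₁ , w₁~w , x₁~x , w₁⊑x₁) (_ , y₁ , w₂~w , y₁~y , w₂⊑y₁)
      with ~-off-pair ¬px x₁~x | ~-off-pair ¬py y₁~y | ~-trans w₁~w (~-sym w₂~w)
    ... | refl | refl | inj₁ refl     = w₁ , m , w₁~w , ~-refl , greatest w₁ w₁⊑x₁ w₂⊑y₁
    ... | refl | refl | inj₂ (pw , _) = ⊥-elim (¬px (pair-upward pw w₁⊑x₁))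

  QMeet-pairˡ : ∀ {x} y → Pair x → IsQMeet x y y
  QMeet-pairˡ y px = QLe-pair y px , QLe-refl y , λ _ _ w≤y → w≤y

  QMeet-pairʳ : ∀ x {y} → Pair y → IsQMeet x y x
  QMeet-pairʳ x py = QLe-refl x , QLe-pair x py , λ _ w≤x _ → w≤x

  quotient-lattice : IsLattice P → IsQLattice
  quotient-lattice lattice = QLe-refl , QLe-trans , QLe-antisym , λ x y → join x y , meet x y
    where
    join : ∀ x y → ∃ λ j → IsQJoin x y j
    join x y with proj₁ (lattice x y)
    ... | j , isJoin = j , join-lifts x y j isJoin

    meet : ∀ x y → ∃ λ m → IsQMeet x y m
    meet x y with Pair? x | Pair? y | proj₂ (lattice x y)
    ... | yes px  | _       | _          = y , QMeet-pairˡ y px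
    ... | no _    | yes py  | _          = x , QMeet-pairʳ x py
    ... | no ¬px  | no ¬py  | m , isMeet = m , meet-lifts x y m ¬px ¬py isMeet

  rep-off-pair : ∀ {y} → ¬ Pair y → IsRep y
  rep-off-pair ¬py w w~y = Fin.≤-reflexive (sym (~-off-pair ¬py w~y))

  rep-unique : ∀ {x y} → IsRep x → IsRep y → x ~ y → x ≡ y
  rep-unique rep-x rep-y x~y = Fin.≤-antisym (rep-x _ (~-sym x~y)) (rep-y _ x~y)

  pair-rep : ∃ λ r → Pair r × IsRep r
  pair-rep with Fin.≤-total c t
  ... | inj₁ c≤t = c , inj₁ refl , λ { _ (inj₁ refl) → Fin.≤-refl
                                     ; _ (inj₂ (inj₁ refl , _)) → Fin.≤-refl
                                     ; _ (inj₂ (inj₂ refl , _)) → c≤t }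
  ... | inj₂ t≤c = t , inj₂ refl , λ { _ (inj₁ refl) → Fin.≤-refl
                                     ; _ (inj₂ (inj₁ refl , _)) → t≤c
                                     ; _ (inj₂ (inj₂ refl , _)) → Fin.≤-refl }

  RepBelow : Fin n → Pred (Fin n) 0ℓ
  RepBelow x y = IsRep y × QLe y x

  RepBelow? : ∀ x → Decidable (RepBelow x)
  RepBelow? x y = IsRep? y ×-dec QLe? y x

  RepBelow⇔⊑ : ∀ {x} → ¬ Pair x → ∀ y → RepBelow x y ⇔ y ⊑ x
  RepBelow⇔⊑ {x} ¬px y =
    mk⇔ below λ y⊑x → rep-off-pair (λ py → ¬px (pair-upward py y⊑x)) , QLe-of-⊑ y⊑x
    where
    below : RepBelow x y → y ⊑ x
    below (_ , y₁ , x₁ , y₁~y , x₁~x , y₁⊑x₁) with ~-off-pair ¬px x₁~x | y₁~y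
    ... | refl | inj₁ refl     = y₁⊑x₁
    ... | refl | inj₂ (py₁ , _) = ⊥-elim (¬px (pair-upward py₁ y₁⊑x₁))

  RepBelow-top∩Pair⇔≡ : ∀ {r} → Pair r → IsRep r → ∀ y → (RepBelow t y × Pair y) ⇔ y ≡ r
  RepBelow-top∩Pair⇔≡ pr rep-r y = mk⇔
    (λ ((rep-y , _) , py) → rep-unique rep-y rep-r (~-trans (pair-~t py) (~-sym (pair-~t pr))))
    λ { refl → (rep-r , QLe-pair _ (inj₂ refl)) , pr }

  module Mobius {z : Fin n} (z-off-pair : ¬ Pair z) (μ μQ : Fin n → ℤ)
    (mobius : IsMobius P z μ) (mobiusQ : IsQMobius z μQ) where
    open ≡-Reasoning

    μQ≡μ-off-pair : ∀ x → ¬ Pair x → μQ x ≡ μ x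
    μQ≡μ-off-pair = sumBelow-injective-on-downset P (∁ Pair)
      (λ y⊑x ¬px py → ¬px (pair-upward py y⊑x)) μQ μ same-sums
      where
      same-sums : ∀ x → ¬ Pair x → sumBelow P μQ x ≡ sumBelow P μ x
      same-sums x ¬px = begin
        sumBelow P μQ x
          ≡⟨ sym (sumWhere-cong (RepBelow? x) (_≤? x) (RepBelow⇔⊑ ¬px) (λ _ _ → refl)) ⟩
        sumWhere (RepBelow? x) μQ
          ≡⟨ sym (sum-filter-elems (RepBelow? x) μQ) ⟩
        sum (map μQ (filter (RepBelow? x) (elems n)))
          ≡⟨ proj₂ mobiusQ x ⟩
        δ (Collapse? c t x z)
          ≡⟨ δ-cong _ (z Fin.≟ x) (mk⇔ (sym ∘ ~-off-pair z-off-pair) (~-sym ∘ inj₁)) ⟩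
        δ (z Fin.≟ x)
          ≡⟨ sym (mobius x) ⟩
        sum (map μ (filter (_≤? x) (elems n)))
          ≡⟨ sum-filter-elems (_≤? x) μ ⟩
        sumBelow P μ x ∎

    offPairSum : ℤ
    offPairSum = sumWhere (∁? Pair?) μ

    quotient-top : μQ t + offPairSum ≡ 0ℤ
    quotient-top = begin
      μQ t + offPairSum
        ≡⟨ cong₂ _+_ (sym pair-part) (sym off-part) ⟩
      sumWhere (RepBelow? t ∩? Pair?) μQ + sumWhere (RepBelow? t ∩? ∁? Pair?) μQ
        ≡⟨ sym (sumWhere-split (RepBelow? t) Pair? μQ) ⟩
      sumWhere (RepBelow? t) μQ
        ≡⟨ sym (sum-filter-elems (RepBelow? t) μQ) ⟩
      sum (map μQ (filter (RepBelow? t) (elems n)))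
        ≡⟨ proj₂ mobiusQ t ⟩
      δ (Collapse? c t t z)
        ≡⟨ δ-no _ (z-off-pair ∘ pair-respects-~ (inj₂ refl)) ⟩
      0ℤ ∎
      where
      pair-part : sumWhere (RepBelow? t ∩? Pair?) μQ ≡ μQ t
      pair-part with pair-rep
      ... | r , pr , rep-r = begin
        sumWhere (RepBelow? t ∩? Pair?) μQ
          ≡⟨ sumWhere-cong (RepBelow? t ∩? Pair?) (Fin._≟ r) (RepBelow-top∩Pair⇔≡ pr rep-r)
               (λ y (_ , py) → proj₁ mobiusQ y t (pair-~t py)) ⟩
        sumWhere (Fin._≟ r) (λ _ → μQ t)
          ≡⟨ sumWhere-≟ r _ ⟩
        μQ t ∎
      off-part : sumWhere (RepBelow? t ∩? ∁? Pair?) μQ ≡ offPairSum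
      off-part = sumWhere-cong (RepBelow? t ∩? ∁? Pair?) (∁? Pair?)
        (λ y → mk⇔ proj₂ λ ¬py → (rep-off-pair ¬py , QLe-of-⊑ (t-max y)) , ¬py)
        (λ y (_ , ¬py) → μQ≡μ-off-pair y ¬py)

    poset-top : (μ c + μ t) + offPairSum ≡ 0ℤ
    poset-top = begin
      (μ c + μ t) + offPairSum
        ≡⟨ cong (_+ offPairSum) (sym pair-part) ⟩
      sumWhere ((_≤? t) ∩? Pair?) μ + offPairSum
        ≡⟨ cong (sumWhere ((_≤? t) ∩? Pair?) μ +_) (sym off-part) ⟩
      sumWhere ((_≤? t) ∩? Pair?) μ + sumWhere ((_≤? t) ∩? ∁? Pair?) μ
        ≡⟨ sym (sumWhere-split (_≤? t) Pair? μ) ⟩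
      sumBelow P μ t
        ≡⟨ sym (sum-filter-elems (_≤? t) μ) ⟩
      sum (map μ (filter (_≤? t) (elems n)))
        ≡⟨ mobius t ⟩
      δ (z Fin.≟ t)
        ≡⟨ δ-no _ (z-off-pair ∘ inj₂) ⟩
      0ℤ ∎
      where
      c≢t : ¬ c ≡ t
      c≢t = proj₁ (proj₂ c-coatom)
      pair-part : sumWhere ((_≤? t) ∩? Pair?) μ ≡ μ c + μ t
      pair-part = begin
        sumWhere ((_≤? t) ∩? Pair?) μ
          ≡⟨ sumWhere-cong ((_≤? t) ∩? Pair?) Pair?
               (λ y → mk⇔ proj₂ (t-max y ,_)) (λ _ _ → refl) ⟩
        sumWhere ((Fin._≟ c) ∪? (Fin._≟ t)) μ
          ≡⟨ sumWhere-∪ (Fin._≟ c) (Fin._≟ t) μ (λ { y (refl , y≡t) → c≢t y≡t }) ⟩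
        sumWhere (Fin._≟ c) μ + sumWhere (Fin._≟ t) μ
          ≡⟨ cong₂ _+_ (sumWhere-≟ c μ) (sumWhere-≟ t μ) ⟩
        μ c + μ t ∎
      off-part : sumWhere ((_≤? t) ∩? ∁? Pair?) μ ≡ offPairSum
      off-part = sumWhere-cong ((_≤? t) ∩? ∁? Pair?) (∁? Pair?)
        (λ y → mk⇔ proj₂ (t-max y ,_)) (λ _ _ → refl)

    μQ-top : μQ t ≡ μ c + μ t
    μQ-top = ∙-cancelʳ offPairSum (μQ t) (μ c + μ t) (trans quotient-top (sym poset-top))

lemma18 : ∀ {n : ℕ} (P : FinPoset n) (z t c : Fin n) →
    3 ≤ n → IsMin P z → IsMax P t → IsCoatom P t c →
    let open Quotient P (Collapse c t) (Collapse? c t) in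
    IsHomogeneous z ×
    (∀ (μ μQ : Fin n → ℤ) → IsMobius P z μ → IsQMobius z μQ → μQ t ≡ μ c + μ t) ×
    (IsLattice P →
    IsQLattice ×
    (∀ x y j → IsJoin P x y j → IsQJoin x y j) ×
    (∀ x y m → ¬ Collapse c t x t → ¬ Collapse c t y t → IsMeet P x y m → IsQMeet x y m))
lemma18 P z t c 3≤n z-min t-max c-coatom =
    isHomogeneous z-off-pair
  , (λ μ μQ mobius mobiusQ → Mobius.μQ-top z-off-pair μ μQ mobius mobiusQ)
  , λ lattice → quotient-lattice lattice
              , join-lifts
              , λ x y m x≁t y≁t → meet-lifts x y m (x≁t ∘ pair-~t) (y≁t ∘ pair-~t)
  where
  open CoatomCollapse P t c t-max c-coatom
  z-off-pair : ¬ Pair z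
  z-off-pair = min-off-pair 3≤n z-min
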